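{- The probabilistic weak call-by-value $\lambda$-calculus $\Lambda_\oplus^{\mathrm{weak}}=(\mathrm{m}\Lambda_\oplus,\Rightarrow)$ satisfies $\mathrm{nf}$-RD: for every multidistribution $\mathrm{m}$ of terms and every two $\Rightarrow$-sequences $\langle\mathrm{r}_n\rangle,\langle\mathrm{s}_n\rangle$ from $\mathrm{m}$, $\mathrm{nf}(\mathrm{r}_n)=\mathrm{nf}(\mathrm{s}_n)$ for all $n$.
   Context: Terms $M::=x\mid\lambda x.M\mid MM\mid M\oplus M$ (the set $\Lambda_\oplus$, up to $\alpha$-equivalence); values $V::=x\mid\lambda x.M$; $M[x:=V]$ is capture-avoiding substitution. The relation $\to\subseteq\Lambda_\oplus\times\mathcal D^{fin}(\Lambda_\oplus)$ (finitely supported probability distributions) is inductively defined by: $(\lambda x.M)V\to\{M[x:=V]^1\}$; $P\oplus Q\to\{P^{1/2}\}+\{Q^{1/2}\}$; if $N\to\{N_i^{p_i}\mid i\in I\}$ then $MN\to\{(MN_i)^{p_i}\mid i\in I\}$; if $M\to\{M_i^{p_i}\mid i\in I\}$ then $MN\to\{(M_iN)^{p_i}\mid i\in I\}$. A term is a normal form if it has no $\to$-reduction; $\mathrm{NF}$ is the set of normal forms. A multidistribution is a finite multiset $[p_iM_i\mid i\in I]$ with $p_i\in(0,1]$, $\sum p_i\le1$; $\mathrm{m}\Lambda_\oplus$ is their set, $[M]=[1M]$, $+$ is multiset union, $q\cdot[p_iM_i]=[(qp_i)M_i]$. $\Rightarrow$ is the least relation on multidistributions with: (L1) $[M]\Rightarrow[M]$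 for $M$ normal; (L2) $[M]\Rightarrow[p_kM_k\mid k\in K]$ if $M\to\{M_k^{p_k}\mid k\in K\}$; (L3) if $[M_i]\Rightarrow\mathrm{m}_i$ for all $i\in I$ then $[p_iM_i\mid i\in I]\Rightarrow\sum_ip_i\cdot\mathrm{m}_i$. For $\mathrm{m}=[p_iM_i]$, $\mathrm{nf}(\mathrm{m})$ is the subdistribution on $\mathrm{NF}$ with $\mathrm{nf}(\mathrm{m})(U)=\sum_{i:M_i=U}p_i$. A $\Rightarrow$-sequence from $\mathrm{m}$ is an infinite sequence $\mathrm{m}=\mathrm{m}_0\Rightarrow\mathrm{m}_1\Rightarrow\cdots$. -}

module Defs where

open import Data.Nat using (ℕ; zero; suc; _<ᵇ_; _≡ᵇ_)
open import Data.Bool using (Bool; true; false; if_then_else_; _∧_)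
open import Data.Rational using (ℚ; 0ℚ; 1ℚ; ½; _+_; _*_; _≤_; _<_)
open import Data.Product using (_×_; _,_; ∃)
open import Data.List using (List; []; _∷_; [_]; _++_; map)
open import Relation.Binary.PropositionalEquality using (_≡_)
open import Relation.Nullary using (¬_)

-- Terms of Λ⊕ (up to α-equivalence): unscoped de Bruijn indices.

data Term : Set where
  var : ℕ → Term
  lam : Term → Term
  app : Term → Term → Term
  _⊕_ : Term → Term → Term

data Value : Term → Set where
  v-var : ∀ {x} → Value (var x)
  v-lam : ∀ {M} → Value (lam M)

shift : ℕ → Term → Term
shift c (var x) = if x <ᵇ c then var x else var (suc x)
shift c (lam M) = lam (shift (suc c) M)
shift c (app M N) = app (shift c M) (shift c N)
shift c (M ⊕ N) = shift c M ⊕ shift c N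

pred : ℕ → ℕ
pred zero = zero
pred (suc n) = n

subst : ℕ → Term → Term → Term
subst j s (var x) = if x ≡ᵇ j then s else (if j <ᵇ x then var (pred x) else var x)
subst j s (lam M) = lam (subst (suc j) (shift 0 s) M)
subst j s (app M N) = app (subst j s M) (subst j s N)
subst j s (M ⊕ N) = subst j s M ⊕ subst j s N

_[0↦_] : Term → Term → Term
M [0↦ V ] = subst 0 V M

_==_ : Term → Term → Bool
var x == var y = x ≡ᵇ y
lam M == lam N = M == N
app M₁ M₂ == app N₁ N₂ = (M₁ == N₁) ∧ (M₂ == N₂)
(M₁ ⊕ M₂) == (N₁ ⊕ N₂) = (M₁ == N₁) ∧ (M₂ == N₂)
_ == _ = false

-- Multidistributions: finite multisets [p_i M_i], represented as lists.

MDist : Set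
MDist = List (ℚ × Term)

⟦_⟧ : Term → MDist
⟦ M ⟧ = [ (1ℚ , M) ]

_·_ : ℚ → MDist → MDist
q · m = map (λ { (p , M) → (q * p , M) }) m

weight : MDist → ℚ
weight [] = 0ℚ
weight ((p , _) ∷ m) = p + weight m

data AllProb : MDist → Set where
  []  : AllProb []
  _∷_ : ∀ {p M m} → (0ℚ < p × p ≤ 1ℚ) → AllProb m → AllProb ((p , M) ∷ m)

IsMDist : MDist → Set
IsMDist m = AllProb m × weight m ≤ 1ℚ

-- One-step reduction M → D, with D ∈ D^fin(Λ⊕) given by its support
-- listed without repetition, together with the probabilities.

choiceDist : Term → Term → MDist
choiceDist P Q = if P == Q then [ (1ℚ , P) ] else (½ , P) ∷ (½ , Q) ∷ []

data _⟶_ : Term → MDist → Set where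
  β    : ∀ {M V} → Value V → app (lam M) V ⟶ ⟦ M [0↦ V ] ⟧
  ⊕-step : ∀ {P Q} → (P ⊕ Q) ⟶ choiceDist P Q
  appR : ∀ {M N d} → N ⟶ d → app M N ⟶ map (λ { (p , Nᵢ) → (p , app M Nᵢ) }) d
  appL : ∀ {M N d} → M ⟶ d → app M N ⟶ map (λ { (p , Mᵢ) → (p , app Mᵢ N) }) d

Normal : Term → Set
Normal M = ∀ d → ¬ (M ⟶ d)

mutual
  data _⇒_ : MDist → MDist → Set where
    L1 : ∀ {M} → Normal M → ⟦ M ⟧ ⇒ ⟦ M ⟧
    L2 : ∀ {M d} → M ⟶ d → ⟦ M ⟧ ⇒ d
    L3 : ∀ {m m′} → m ⇒* m′ → m ⇒ m′

  data _⇒*_ : MDist → MDist → Set where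
    []  : [] ⇒* []
    _∷_ : ∀ {p M mᵢ ms ms′} → ⟦ M ⟧ ⇒ mᵢ → ms ⇒* ms′ →
          ((p , M) ∷ ms) ⇒* ((p · mᵢ) ++ ms′)

-- nf(m)(U) = Σ_{i : M_i = U} p_i   (meaningful for U ∈ NF)

nf : MDist → Term → ℚ
nf [] U = 0ℚ
nf ((p , M) ∷ m) U = if M == U then p + nf m U else nf m U

IsSeqFrom : MDist → (ℕ → MDist) → Set
IsSeqFrom m r = (r 0 ≡ m) × (∀ n → r n ⇒ r (suc n))

-- Two different steps M ⟶ d₁, M ⟶ d₂ are joinable up to expectation: either d₁ = d₂,
-- or reducing every term of d₁ and every term of d₂ once more yields multidistributions
-- with the same expectation of every function.  Fix the leftmost strategy and let
-- after k M U be the probability that k of its steps lead from M to U.  Joinability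
-- shows by induction on k that every step M ⟶ d satisfies 𝔼_d (after k · U) =
-- after (k + 1) M U for normal U, hence every m ⇒ m′ satisfies
-- 𝔼_m′ (after k · U) = 𝔼_m (after (k + 1) · U).  Along any ⇒-sequence from m this gives
-- nf (rₙ) U = 𝔼_m (after n · U), which does not depend on the sequence.
module Submission where

open import Defs
open import Data.Nat using (ℕ)
open import Relation.Binary.PropositionalEquality using (_≡_)

open import Data.Nat using (zero; suc)
open import Data.Nat.Properties using (≡ᵇ⇒≡)
open import Data.Bool using (true; false; T; if_then_else_)
open import Data.Bool.Properties using (T-∧)
open import Data.Rational using (ℚ; 0ℚ; 1ℚ; _+_; _*_)
open import Data.Rational.Properties using (*-zeroʳ; *-identityˡ; *-identityʳ; +-identityˡ; +-identityʳ; +-assoc)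
open import Data.Rational.Solver using (module +-*-Solver)
open import Data.Product using (_×_; _,_; Σ)
open import Data.Sum using (_⊎_; inj₁; inj₂)
open import Data.List using ([]; _∷_; _++_; map)
open import Data.List.Properties using (map-++; map-∘)
open import Data.Empty using (⊥-elim)
open import Function using (_∘_; Equivalence)
open import Relation.Nullary using (¬_)
open import Relation.Binary.PropositionalEquality as Eq using (refl; sym; trans; cong; cong₂; module ≡-Reasoning)

open +-*-Solver using (solve; _:+_; _:*_; _:=_)
open ≡-Reasoning

lift : (Term → Term) → ℚ × Term → ℚ × Term
lift h (p , M) = (p , h M)

𝔼 : (Term → ℚ) → MDist → ℚ
𝔼 f [] = 0ℚ
𝔼 f ((p , M) ∷ m) = p * f M + 𝔼 f m

𝔼-++ : ∀ f a b → 𝔼 f (a ++ b) ≡ 𝔼 f a + 𝔼 f b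
𝔼-++ f [] b = sym (+-identityˡ _)
𝔼-++ f ((p , M) ∷ a) b = begin
  p * f M + 𝔼 f (a ++ b)        ≡⟨ cong (p * f M +_) (𝔼-++ f a b) ⟩
  p * f M + (𝔼 f a + 𝔼 f b)     ≡⟨ sym (+-assoc (p * f M) (𝔼 f a) (𝔼 f b)) ⟩
  p * f M + 𝔼 f a + 𝔼 f b       ∎

𝔼-· : ∀ f q a → 𝔼 f (q · a) ≡ q * 𝔼 f a
𝔼-· f q [] = sym (*-zeroʳ q)
𝔼-· f q ((p , M) ∷ a) = begin
  q * p * f M + 𝔼 f (q · a)     ≡⟨ cong (q * p * f M +_) (𝔼-· f q a) ⟩
  q * p * f M + q * 𝔼 f a       ≡⟨ distrib q p (f M) (𝔼 f a) ⟩
  q * (p * f M + 𝔼 f a)         ∎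
  where
  distrib : ∀ q p x s → q * p * x + q * s ≡ q * (p * x + s)
  distrib = solve 4 (λ q p x s → q :* p :* x :+ q :* s := q :* (p :* x :+ s)) refl

𝔼-mixture : ∀ f p a b → 𝔼 f ((p · a) ++ b) ≡ p * 𝔼 f a + 𝔼 f b
𝔼-mixture f p a b = trans (𝔼-++ f (p · a) b) (cong (_+ 𝔼 f b) (𝔼-· f p a))

𝔼-singleton : ∀ f M → 𝔼 f ⟦ M ⟧ ≡ f M
𝔼-singleton f M = trans (+-identityʳ (1ℚ * f M)) (*-identityˡ (f M))

𝔼-map : ∀ f h a → 𝔼 f (map (lift h) a) ≡ 𝔼 (f ∘ h) a
𝔼-map f h [] = refl
𝔼-map f h ((p , M) ∷ a) = cong (p * f (h M) +_) (𝔼-map f h a)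

𝔼-cong : ∀ {f g} → (∀ M → f M ≡ g M) → ∀ a → 𝔼 f a ≡ 𝔼 g a
𝔼-cong f≡g [] = refl
𝔼-cong f≡g ((p , M) ∷ a) = cong₂ (λ x y → p * x + y) (f≡g M) (𝔼-cong f≡g a)

𝔼-zero : ∀ a → 𝔼 (λ _ → 0ℚ) a ≡ 0ℚ
𝔼-zero [] = refl
𝔼-zero ((p , M) ∷ a) = begin
  p * 0ℚ + 𝔼 (λ _ → 0ℚ) a       ≡⟨ cong₂ _+_ (*-zeroʳ p) (𝔼-zero a) ⟩
  0ℚ + 0ℚ                       ≡⟨ +-identityˡ 0ℚ ⟩
  0ℚ                            ∎

𝔼-+ : ∀ f g a → 𝔼 (λ M → f M + g M) a ≡ 𝔼 f a + 𝔼 g a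
𝔼-+ f g [] = sym (+-identityˡ 0ℚ)
𝔼-+ f g ((p , M) ∷ a) = begin
  p * (f M + g M) + 𝔼 (λ M → f M + g M) a  ≡⟨ cong (p * (f M + g M) +_) (𝔼-+ f g a) ⟩
  p * (f M + g M) + (𝔼 f a + 𝔼 g a)        ≡⟨ distrib p (f M) (g M) (𝔼 f a) (𝔼 g a) ⟩
  (p * f M + 𝔼 f a) + (p * g M + 𝔼 g a)    ∎
  where
  distrib : ∀ p x y s t → p * (x + y) + (s + t) ≡ (p * x + s) + (p * y + t)
  distrib = solve 5 (λ p x y s t → p :* (x :+ y) :+ (s :+ t) := (p :* x :+ s) :+ (p :* y :+ t)) refl

𝔼-scale : ∀ q f a → 𝔼 (λ M → q * f M) a ≡ q * 𝔼 f a
𝔼-scale q f [] = sym (*-zeroʳ q)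
𝔼-scale q f ((p , M) ∷ a) = begin
  p * (q * f M) + 𝔼 (λ M → q * f M) a      ≡⟨ cong (p * (q * f M) +_) (𝔼-scale q f a) ⟩
  p * (q * f M) + q * 𝔼 f a                ≡⟨ distrib p q (f M) (𝔼 f a) ⟩
  q * (p * f M + 𝔼 f a)                    ∎
  where
  distrib : ∀ p q x s → p * (q * x) + q * s ≡ q * (p * x + s)
  distrib = solve 4 (λ p q x s → p :* (q :* x) :+ q :* s := q :* (p :* x :+ s)) refl

𝔼-swap : ∀ (g : Term → Term → ℚ) a b →
         𝔼 (λ M → 𝔼 (g M) b) a ≡ 𝔼 (λ N → 𝔼 (λ M → g M N) a) b
𝔼-swap g [] b = sym (𝔼-zero b)
𝔼-swap g ((p , M) ∷ a) b = begin
  p * 𝔼 (g M) b + 𝔼 (λ M → 𝔼 (g M) b) a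
    ≡⟨ cong₂ _+_ (sym (𝔼-scale p (g M) b)) (𝔼-swap g a b) ⟩
  𝔼 (λ N → p * g M N) b + 𝔼 (λ N → 𝔼 (λ M → g M N) a) b
    ≡⟨ sym (𝔼-+ (λ N → p * g M N) (λ N → 𝔼 (λ M → g M N) a) b) ⟩
  𝔼 (λ N → p * g M N + 𝔼 (λ M → g M N) a) b
    ∎

bind : MDist → (Term → MDist) → MDist
bind [] k = []
bind ((p , M) ∷ m) k = (p · k M) ++ bind m k

𝔼-bind : ∀ f m k → 𝔼 f (bind m k) ≡ 𝔼 (λ M → 𝔼 f (k M)) m
𝔼-bind f [] k = refl
𝔼-bind f ((p , M) ∷ m) k = trans (𝔼-mixture f p (k M) (bind m k)) (cong (p * 𝔼 f (k M) +_) (𝔼-bind f m k))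

record _≈_ (a b : MDist) : Set where
  constructor mk≈
  field 𝔼-≡ : ∀ f → 𝔼 f a ≡ 𝔼 f b
open _≈_

≈-sym : ∀ {a b} → a ≈ b → b ≈ a
≈-sym a≈b = mk≈ λ f → sym (𝔼-≡ a≈b f)

≈-trans : ∀ {a b c} → a ≈ b → b ≈ c → a ≈ c
≈-trans a≈b b≈c = mk≈ λ f → trans (𝔼-≡ a≈b f) (𝔼-≡ b≈c f)

≈-map : ∀ h {a b} → a ≈ b → map (lift h) a ≈ map (lift h) b
≈-map h {a} {b} a≈b = mk≈ λ f → begin
  𝔼 f (map (lift h) a)  ≡⟨ 𝔼-map f h a ⟩
  𝔼 (f ∘ h) a           ≡⟨ 𝔼-≡ a≈b (f ∘ h) ⟩
  𝔼 (f ∘ h) b           ≡⟨ sym (𝔼-map f h b) ⟩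
  𝔼 f (map (lift h) b)  ∎

data _⟶ᵐ_ : MDist → MDist → Set where
  []  : [] ⟶ᵐ []
  _∷_ : ∀ {p M e ms ms′} → M ⟶ e → ms ⟶ᵐ ms′ → ((p , M) ∷ ms) ⟶ᵐ ((p · e) ++ ms′)

map-mixture : ∀ h p a b → map (lift h) ((p · a) ++ b) ≡ (p · map (lift h) a) ++ map (lift h) b
map-mixture h p a b = trans (map-++ (lift h) (p · a) b)
                            (cong (_++ map (lift h) b) (trans (sym (map-∘ a)) (map-∘ a)))

Compatible : (Term → Term) → Set
Compatible h = ∀ {M e} → M ⟶ e → h M ⟶ map (lift h) e

⟶ᵐ-map : ∀ {h} → Compatible h → ∀ {a b} → a ⟶ᵐ b → map (lift h) a ⟶ᵐ map (lift h) b
⟶ᵐ-map h-step [] = []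
⟶ᵐ-map {h} h-step (_∷_ {p} {M} {e} {ms} {ms′} M⟶e ms⟶ms′) =
  Eq.subst (map (lift h) ((p , M) ∷ ms) ⟶ᵐ_) (sym (map-mixture h p e ms′))
        (h-step M⟶e ∷ ⟶ᵐ-map h-step ms⟶ms′)

⟶ᵐ-bind : ∀ {g k} → (∀ M → g M ⟶ k M) → ∀ m → map (lift g) m ⟶ᵐ bind m k
⟶ᵐ-bind g⟶k [] = []
⟶ᵐ-bind g⟶k ((p , M) ∷ m) = g⟶k M ∷ ⟶ᵐ-bind g⟶k m

Joinable : MDist → MDist → Set
Joinable d₁ d₂ = (d₁ ≡ d₂) ⊎ Σ MDist λ e₁ → Σ MDist λ e₂ → d₁ ⟶ᵐ e₁ × d₂ ⟶ᵐ e₂ × e₁ ≈ e₂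

Joinable-map : ∀ {h} → Compatible h → ∀ {d₁ d₂} → Joinable d₁ d₂ →
               Joinable (map (lift h) d₁) (map (lift h) d₂)
Joinable-map h-step (inj₁ refl) = inj₁ refl
Joinable-map {h} h-step (inj₂ (e₁ , e₂ , d₁⟶e₁ , d₂⟶e₂ , e₁≈e₂)) =
  inj₂ (_ , _ , ⟶ᵐ-map h-step d₁⟶e₁ , ⟶ᵐ-map h-step d₂⟶e₂ , ≈-map h e₁≈e₂)

-- Both orders of reducing the two sides of an application give the product law.
appL-appR-joinable : ∀ {M N dM dN} (sM : M ⟶ dM) (sN : N ⟶ dN) →
                     Joinable (map (lift (λ Z → app Z N)) dM) (map (lift (app M)) dN)
appL-appR-joinable {M} {N} {dM} {dN} sM sN =
  inj₂ (_ , _ , ⟶ᵐ-bind (λ _ → appR sN) dM , ⟶ᵐ-bind (λ _ → appL sM) dN , mk≈ product-law)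
  where
  product-law : ∀ f → 𝔼 f (bind dM (λ Mᵢ → map (lift (app Mᵢ)) dN))
                    ≡ 𝔼 f (bind dN (λ Nⱼ → map (lift (λ Z → app Z Nⱼ)) dM))
  product-law f = begin
    𝔼 f (bind dM (λ Mᵢ → map (lift (app Mᵢ)) dN))
      ≡⟨ 𝔼-bind f dM _ ⟩
    𝔼 (λ Mᵢ → 𝔼 f (map (lift (app Mᵢ)) dN)) dM
      ≡⟨ 𝔼-cong (λ Mᵢ → 𝔼-map f (app Mᵢ) dN) dM ⟩
    𝔼 (λ Mᵢ → 𝔼 (λ Nⱼ → f (app Mᵢ Nⱼ)) dN) dM
      ≡⟨ 𝔼-swap (λ Mᵢ Nⱼ → f (app Mᵢ Nⱼ)) dM dN ⟩
    𝔼 (λ Nⱼ → 𝔼 (λ Mᵢ → f (app Mᵢ Nⱼ)) dM) dN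
      ≡⟨ sym (𝔼-cong (λ Nⱼ → 𝔼-map f (λ Z → app Z Nⱼ) dM) dN) ⟩
    𝔼 (λ Nⱼ → 𝔼 f (map (lift (λ Z → app Z Nⱼ)) dM)) dN
      ≡⟨ sym (𝔼-bind f dN _) ⟩
    𝔼 f (bind dN (λ Nⱼ → map (lift (λ Z → app Z Nⱼ)) dM))
      ∎

Joinable-sym : ∀ {d₁ d₂} → Joinable d₁ d₂ → Joinable d₂ d₁
Joinable-sym (inj₁ refl) = inj₁ refl
Joinable-sym (inj₂ (e₁ , e₂ , d₁⟶e₁ , d₂⟶e₂ , e₁≈e₂)) = inj₂ (e₂ , e₁ , d₂⟶e₂ , d₁⟶e₁ , ≈-sym e₁≈e₂)

value-normal : ∀ {V} → Value V → Normal V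
value-normal v-var _ ()
value-normal v-lam _ ()

⟶-joinable : ∀ {M d₁ d₂} → M ⟶ d₁ → M ⟶ d₂ → Joinable d₁ d₂
⟶-joinable (β _) (β _) = inj₁ refl
⟶-joinable (β v) (appR s) = ⊥-elim (value-normal v _ s)
⟶-joinable (appR s) (β v) = ⊥-elim (value-normal v _ s)
⟶-joinable ⊕-step ⊕-step = inj₁ refl
⟶-joinable {app M _} (appR s₁) (appR s₂) = Joinable-map {app M} appR (⟶-joinable s₁ s₂)
⟶-joinable {app _ N} (appL s₁) (appL s₂) = Joinable-map {λ Z → app Z N} appL (⟶-joinable s₁ s₂)
⟶-joinable (appL s₁) (appR s₂) = appL-appR-joinable s₁ s₂
⟶-joinable (appR s₁) (appL s₂) = Joinable-sym (appL-appR-joinable s₂ s₁)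

data Progress (M : Term) : Set where
  done : Normal M → Progress M
  step : ∀ {d} → M ⟶ d → Progress M

app-normal : ∀ {M N} → Normal M → Normal N → (∀ {B} → M ≡ lam B → ¬ Value N) → Normal (app M N)
app-normal nM nN no-β _ (β v) = no-β refl v
app-normal nM nN no-β _ (appR s) = nN _ s
app-normal nM nN no-β _ (appL s) = nM _ s

progress-app : ∀ M N → Normal M → Normal N → Progress (app M N)
progress-app (lam _) (var _) nM nN = step (β v-var)
progress-app (lam _) (lam _) nM nN = step (β v-lam)
progress-app (lam _) (app _ _) nM nN = done (app-normal nM nN λ _ ())
progress-app (lam _) (_ ⊕ _) nM nN = done (app-normal nM nN λ _ ())
progress-app (var _) N nM nN = done (app-normal nM nN λ ())
progress-app (app _ _) N nM nN = done (app-normal nM nN λ ())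
progress-app (_ ⊕ _) N nM nN = done (app-normal nM nN λ ())

progress : ∀ M → Progress M
progress (var _) = done λ _ ()
progress (lam _) = done λ _ ()
progress (P ⊕ Q) = step ⊕-step
progress (app M N) with progress M | progress N
... | step sM | _       = step (appL sM)
... | done nM | step sN = step (appR sN)
... | done nM | done nN = progress-app M N nM nN

-- Normal terms are fixed points of the strategy, as in rule L1.
mutual
  after : ℕ → Term → Term → ℚ
  after zero M U = if M == U then 1ℚ else 0ℚ
  after (suc k) M U = afterProgress k (progress M) U

  afterProgress : ℕ → ∀ {M} → Progress M → Term → ℚ
  afterProgress k {M} (done _) U = after k M U
  afterProgress k (step {d} _) U = afterᵐ k d U

  afterᵐ : ℕ → MDist → Term → ℚ
  afterᵐ k m U = 𝔼 (λ N → after k N U) m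

==-sound : ∀ M U → T (M == U) → M ≡ U
==-sound (var x) (var y) t = cong var (≡ᵇ⇒≡ x y t)
==-sound (lam M) (lam U) t = cong lam (==-sound M U t)
==-sound (app M₁ M₂) (app U₁ U₂) t with Equivalence.to T-∧ t
... | t₁ , t₂ = cong₂ app (==-sound M₁ U₁ t₁) (==-sound M₂ U₂ t₂)
==-sound (M₁ ⊕ M₂) (U₁ ⊕ U₂) t with Equivalence.to T-∧ t
... | t₁ , t₂ = cong₂ _⊕_ (==-sound M₁ U₁ t₁) (==-sound M₂ U₂ t₂)
==-sound (var _) (lam _) ()
==-sound (var _) (app _ _) ()
==-sound (var _) (_ ⊕ _) ()
==-sound (lam _) (var _) ()
==-sound (lam _) (app _ _) ()
==-sound (lam _) (_ ⊕ _) ()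
==-sound (app _ _) (var _) ()
==-sound (app _ _) (lam _) ()
==-sound (app _ _) (_ ⊕ _) ()
==-sound (_ ⊕ _) (var _) ()
==-sound (_ ⊕ _) (lam _) ()
==-sound (_ ⊕ _) (app _ _) ()

nf≡afterᵐ-zero : ∀ m U → nf m U ≡ afterᵐ 0 m U
nf≡afterᵐ-zero [] U = refl
nf≡afterᵐ-zero ((p , M) ∷ m) U with M == U
... | true  = cong₂ _+_ (sym (*-identityʳ p)) (nf≡afterᵐ-zero m U)
... | false = trans (nf≡afterᵐ-zero m U) (sym (trans (cong (_+ afterᵐ 0 m U) (*-zeroʳ p)) (+-identityˡ _)))

module _ {U : Term} (U-normal : Normal U) where

  reducible-after-zero : ∀ {M e} → M ⟶ e → after 0 M U ≡ 0ℚ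
  reducible-after-zero {M} {e} M⟶e with M == U in M==U
  ... | true  = ⊥-elim (U-normal e (Eq.subst (_⟶ e) (==-sound M U (Eq.subst T (sym M==U) _)) M⟶e))
  ... | false = refl

  ⟶ᵐ-afterᵐ-zero : ∀ {d e} → d ⟶ᵐ e → afterᵐ 0 d U ≡ 0ℚ
  ⟶ᵐ-afterᵐ-zero [] = refl
  ⟶ᵐ-afterᵐ-zero (_∷_ {p} M⟶e ms⟶ms′) = begin
    p * _ + _        ≡⟨ cong₂ (λ x y → p * x + y) (reducible-after-zero M⟶e) (⟶ᵐ-afterᵐ-zero ms⟶ms′) ⟩
    p * 0ℚ + 0ℚ      ≡⟨ +-identityʳ (p * 0ℚ) ⟩
    p * 0ℚ           ≡⟨ *-zeroʳ p ⟩
    0ℚ               ∎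

  mutual
    ⟶-afterᵐ : ∀ k {M d₁ d₂} → M ⟶ d₁ → M ⟶ d₂ → afterᵐ k d₁ U ≡ afterᵐ k d₂ U
    ⟶-afterᵐ k s₁ s₂ with ⟶-joinable s₁ s₂
    ... | inj₁ refl = refl
    ⟶-afterᵐ zero s₁ s₂ | inj₂ (_ , _ , d₁⟶e₁ , d₂⟶e₂ , _) =
      trans (⟶ᵐ-afterᵐ-zero d₁⟶e₁) (sym (⟶ᵐ-afterᵐ-zero d₂⟶e₂))
    ⟶-afterᵐ (suc k) {d₁ = d₁} {d₂} s₁ s₂ | inj₂ (e₁ , e₂ , d₁⟶e₁ , d₂⟶e₂ , e₁≈e₂) = begin
      afterᵐ (suc k) d₁ U  ≡⟨ sym (⟶ᵐ-afterᵐ k d₁⟶e₁) ⟩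
      afterᵐ k e₁ U        ≡⟨ 𝔼-≡ e₁≈e₂ (λ N → after k N U) ⟩
      afterᵐ k e₂ U        ≡⟨ ⟶ᵐ-afterᵐ k d₂⟶e₂ ⟩
      afterᵐ (suc k) d₂ U  ∎

    ⟶-after : ∀ k {M d} → M ⟶ d → afterᵐ k d U ≡ after (suc k) M U
    ⟶-after k {M} M⟶d with progress M
    ... | done nM     = ⊥-elim (nM _ M⟶d)
    ... | step M⟶d′  = ⟶-afterᵐ k M⟶d M⟶d′

    ⟶ᵐ-afterᵐ : ∀ k {d e} → d ⟶ᵐ e → afterᵐ k e U ≡ afterᵐ (suc k) d U
    ⟶ᵐ-afterᵐ k [] = refl
    ⟶ᵐ-afterᵐ k (_∷_ {p} {M} {e} {ms} {ms′} M⟶e ms⟶ms′) = begin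
      afterᵐ k ((p · e) ++ ms′) U           ≡⟨ 𝔼-mixture _ p e ms′ ⟩
      p * afterᵐ k e U + afterᵐ k ms′ U     ≡⟨ cong₂ (λ x y → p * x + y) (⟶-after k M⟶e) (⟶ᵐ-afterᵐ k ms⟶ms′) ⟩
      afterᵐ (suc k) ((p , M) ∷ ms) U       ∎

  mutual
    ⇒-afterᵐ : ∀ k {m m′} → m ⇒ m′ → afterᵐ k m′ U ≡ afterᵐ (suc k) m U
    ⇒-afterᵐ k (L1 {M} nM) with progress M
    ... | done _    = refl
    ... | step M⟶d = ⊥-elim (nM _ M⟶d)
    ⇒-afterᵐ k (L2 {M} M⟶d) =
      trans (⟶-after k M⟶d) (sym (𝔼-singleton (λ N → after (suc k) N U) M))
    ⇒-afterᵐ k (L3 m⇒*m′) = ⇒*-afterᵐ k m⇒*m′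

    ⇒*-afterᵐ : ∀ k {m m′} → m ⇒* m′ → afterᵐ k m′ U ≡ afterᵐ (suc k) m U
    ⇒*-afterᵐ k [] = refl
    ⇒*-afterᵐ k (_∷_ {p} {M} {mᵢ} {ms} {ms′} M⇒mᵢ ms⇒*ms′) = begin
      afterᵐ k ((p · mᵢ) ++ ms′) U          ≡⟨ 𝔼-mixture _ p mᵢ ms′ ⟩
      p * afterᵐ k mᵢ U + afterᵐ k ms′ U    ≡⟨ cong₂ (λ x y → p * x + y) M-step (⇒*-afterᵐ k ms⇒*ms′) ⟩
      afterᵐ (suc k) ((p , M) ∷ ms) U       ∎
      where
      M-step : afterᵐ k mᵢ U ≡ after (suc k) M U
      M-step = trans (⇒-afterᵐ k M⇒mᵢ) (𝔼-singleton (λ N → after (suc k) N U) M)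

  nf-along : ∀ (r : ℕ → MDist) → (∀ n → r n ⇒ r (suc n)) → ∀ n → nf (r n) U ≡ afterᵐ n (r 0) U
  nf-along r r⇒ zero = nf≡afterᵐ-zero (r 0) U
  nf-along r r⇒ (suc n) = trans (nf-along (r ∘ suc) (r⇒ ∘ suc) n) (⇒-afterᵐ n (r⇒ 0))

mainTheorem16 : ∀ (m : MDist) → IsMDist m →
    ∀ (r s : ℕ → MDist) → IsSeqFrom m r → IsSeqFrom m s →
    ∀ (n : ℕ) (U : Term) → Normal U → nf (r n) U ≡ nf (s n) U
mainTheorem16 m _ r s (r₀≡m , r⇒) (s₀≡m , s⇒) n U U-normal = begin
  nf (r n) U        ≡⟨ nf-along U-normal r r⇒ n ⟩
  afterᵐ n (r 0) U  ≡⟨ cong (λ m₀ → afterᵐ n m₀ U) (trans r₀≡m (sym s₀≡m)) ⟩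
  afterᵐ n (s 0) U  ≡⟨ sym (nf-along U-normal s s⇒ n) ⟩
  nf (s n) U        ∎
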